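{- Let $\Sigma$ be any subexponential signature. (1) For every $\mathrm{SMALC}_\Sigma$-formula $A$, $\natural(\widehat A)=0$. (2) For every $\mathrm{SMALC}_\Sigma$-formula $A$, $\natural(\widehat A^\bot)=1$. (3) If a formula $A\oplus B$ is of the form $\widehat C$ or $\widehat C^\bot$ for some $\mathrm{SMALC}_\Sigma$-formula $C$, then $\natural(A)=\natural(B)=\natural(A\oplus B)$. (4) If each $A_i$, $i=1,\dots,n$, is of the form $\widehat C$ or $\widehat C^\bot$ for some $\mathrm{SMALC}_\Sigma$-formula $C$, and the sequent $\vdash A_1,\dots,A_n$ is derivable in (cut-free) $\mathrm{SCLL}_\Sigma$, then $\natural(A_1)+\dots+\natural(A_n)=n-1$.
   Context: A subexponential signature is a tuple $\Sigma = \langle \mathcal{I}, \preceq, \mathcal{W}, \mathcal{C}, \mathcal{E}\rangle$ with $\mathcal{I}$ a finite set of labels, $\preceq$ a preorder on $\mathcal{I}$, $\mathcal{W},\mathcal{C},\mathcal{E}\subseteq\mathcal{I}$ upwardly closed w.r.t. $\preceq$, and $\mathcal{W}\cap\mathcal{C}\subseteq\mathcal{E}$. $\mathrm{SMALC}_\Sigma$-formulae are built from variables $p_1,p_2,\dots$ and $\mathbf{1}$ using $\cdot,\backslash,/,\wedge,\vee$ and ${!}^s$ ($s\in\mathcal{I}$). $\mathrm{SCLL}_\Sigma$: atoms $p_i,\bar p_i$; formulae from atoms and $\mathbf{1},\bot,\top,\mathbf{0}$ using $\otimes$, $\wp$ (par), $\mathbin{\&}$, $\oplus$, ${!}^s$,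 ${?}^s$. Negation: $p_i^\bot=\bar p_i$, $\bar p_i^\bot=p_i$, $(A\otimes B)^\bot=B^\bot\wp A^\bot$, $(A\wp B)^\bot=B^\bot\otimes A^\bot$, $(A\oplus B)^\bot=A^\bot\mathbin{\&}B^\bot$, $(A\mathbin{\&}B)^\bot=A^\bot\oplus B^\bot$, $({!}^sA)^\bot={?}^sA^\bot$, $({?}^sA)^\bot={!}^sA^\bot$, $\mathbf{1}^\bot=\bot$, $\bot^\bot=\mathbf{1}$, $\mathbf{0}^\bot=\top$, $\top^\bot=\mathbf{0}$. Sequents $\vdash\Gamma$, $\Gamma$ a nonempty cyclically ordered sequence ($\vdash\Gamma_1,\Gamma_2$ identified with $\vdash\Gamma_2,\Gamma_1$, no other permutations). Rules of cut-free $\mathrm{SCLL}_\Sigma$ (premises / conclusion): $\vdash A,A^\bot$; $\vdash\Gamma,A$, $\vdash B,\Delta\ /\ \vdash\Gamma,A\otimes B,\Delta$; $\vdash A,B,\Gamma\ /\ \vdash A\wp B,\Gamma$; $\vdash A_1,\Gamma$, $\vdash A_2,\Gamma\ /\ \vdash A_1\mathbin{\&}A_2,\Gamma$; $\vdash A_i,\Gamma\ /\ \vdash A_1\oplus A_2,\Gamma$; $\vdash\mathbf{1}$; $\vdash\Gamma\ /\ \vdash\bot,\Gamma$; $\vdash\top,\Gamma$; $\vdash B,{?}^{s_1}A_1,\dots,{?}^{s_n}A_n\ /\ \vdash{!}^sB,{?}^{s_1}A_1,\dots,{?}^{s_n}A_n$ if $s\preceq s_j$ for all $j$; $\vdash A,\Gamma\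 /\ \vdash{?}^sA,\Gamma$; for $s\in\mathcal{W}$: $\vdash\Gamma\ /\ \vdash{?}^sA,\Gamma$; for $s\in\mathcal{C}$: $\vdash{?}^sA,\Gamma,{?}^sA,\Delta\ /\ \vdash{?}^sA,\Gamma,\Delta$; for $s\in\mathcal{E}$: $\vdash\Gamma,{?}^sA,\Delta\ /\ \vdash{?}^sA,\Gamma,\Delta$. No rule for $\mathbf{0}$; no cut. Translation: $\widehat{p_i}=p_i$, $\widehat{\mathbf{1}}=\mathbf{1}$, $\widehat{A\cdot B}=\widehat A\otimes\widehat B$, $\widehat{A\backslash B}=\widehat A^\bot\wp\widehat B$, $\widehat{B/A}=\widehat B\wp\widehat A^\bot$, $\widehat{A\wedge B}=\widehat A\mathbin{\&}\widehat B$, $\widehat{A\vee B}=\widehat A\oplus\widehat B$, $\widehat{{!}^sA}={!}^s\widehat A$. The counter $\natural$ on $\mathrm{SCLL}_\Sigma$-formulae not containing $\top,\mathbf{0}$: $\natural(p)=0$, $\natural(\bar p)=1$, $\natural(\mathbf{1})=0$, $\natural(\bot)=1$, $\natural(A\wp B)=\natural(A)+\natural(B)-1$, $\natural(A\otimes B)=\natural(A)+\natural(B)$, $\natural(A\oplus B)=\natural(A\mathbin{\&}B)=\natural(A)$, $\natural({?}^sA)=\natural({!}^sA)=\natural(A)$. -}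

module Defs where

open import Data.Nat using (ℕ)
open import Data.Fin using (Fin)
open import Data.Integer using (ℤ; +_; _+_; _-_)
open import Data.List using (List; []; _∷_; _++_; map)
open import Data.List.Relation.Unary.All using (All)
open import Data.Product using (_×_; _,_)

record Signature : Set₁ where
  field
    size   : ℕ
    _≼_    : Fin size → Fin size → Set
    ≼-refl  : ∀ s → s ≼ s
    ≼-trans : ∀ {s t u} → s ≼ t → t ≼ u → s ≼ u
    W C E  : Fin size → Set
    W-up   : ∀ {s t} → s ≼ t → W s → W t
    C-up   : ∀ {s t} → s ≼ t → C s → C t
    E-up   : ∀ {s t} → s ≼ t → E s → E t
    WC⊆E   : ∀ s → W s → C s → E s

module _ (Σ : Signature) where
  open Signature Σ

  Label : Set
  Label = Fin size

  data MFm : Set where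
    var  : ℕ → MFm
    one  : MFm
    _·_  : MFm → MFm → MFm
    _＼_ : MFm → MFm → MFm
    _／_ : MFm → MFm → MFm   -- B ／ A  is  B / A
    _∧_  : MFm → MFm → MFm
    _∨_  : MFm → MFm → MFm
    !ₘ   : Label → MFm → MFm

  data Fm : Set where
    pos  : ℕ → Fm
    neg  : ℕ → Fm
    𝟙 ⊥ᶠ ⊤ᶠ 𝟘 : Fm
    _⊗_  : Fm → Fm → Fm
    _⅋_  : Fm → Fm → Fm
    _&_  : Fm → Fm → Fm
    _⊕_  : Fm → Fm → Fm
    ！   : Label → Fm → Fm
    ？   : Label → Fm → Fm

  _ᗮ : Fm → Fm
  pos i ᗮ = neg i
  neg i ᗮ = pos i
  𝟙 ᗮ = ⊥ᶠ
  ⊥ᶠ ᗮ = 𝟙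
  ⊤ᶠ ᗮ = 𝟘
  𝟘 ᗮ = ⊤ᶠ
  (A ⊗ B) ᗮ = (B ᗮ) ⅋ (A ᗮ)
  (A ⅋ B) ᗮ = (B ᗮ) ⊗ (A ᗮ)
  (A & B) ᗮ = (A ᗮ) ⊕ (B ᗮ)
  (A ⊕ B) ᗮ = (A ᗮ) & (B ᗮ)
  ！ s A ᗮ = ？ s (A ᗮ)
  ？ s A ᗮ = ！ s (A ᗮ)

  tr : MFm → Fm
  tr (var i) = pos i
  tr one = 𝟙
  tr (A · B) = tr A ⊗ tr B
  tr (A ＼ B) = (tr A ᗮ) ⅋ tr B
  tr (B ／ A) = tr B ⅋ (tr A ᗮ)
  tr (A ∧ B) = tr A & tr B
  tr (A ∨ B) = tr A ⊕ tr B
  tr (!ₘ s A) = ！ s (tr A)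

  -- the counter ♮ (⊤ and 𝟘 are outside its intended domain; they get the
  -- arbitrary value 0, which never matters for formulas of the form Ĉ or Ĉ^⊥)
  ♮ : Fm → ℤ
  ♮ (pos _) = + 0
  ♮ (neg _) = + 1
  ♮ 𝟙 = + 0
  ♮ ⊥ᶠ = + 1
  ♮ ⊤ᶠ = + 0
  ♮ 𝟘 = + 0
  ♮ (A ⅋ B) = ♮ A + ♮ B - + 1
  ♮ (A ⊗ B) = ♮ A + ♮ B
  ♮ (A ⊕ B) = ♮ A
  ♮ (A & B) = ♮ A
  ♮ (？ _ A) = ♮ A
  ♮ (！ _ A) = ♮ A

  ？ctx : List (Label × Fm) → List Fm
  ？ctx = map (λ { (t , A) → ？ t A })

  -- cut-free SCLL_Σ. Sequents are lists; the cyclic identification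
  -- ⊢ Γ₁,Γ₂ = ⊢ Γ₂,Γ₁ is realised by the rotation rule `rot`.
  data ⊢_ : List Fm → Set where
    rot  : ∀ Γ₁ Γ₂ → ⊢ (Γ₁ ++ Γ₂) → ⊢ (Γ₂ ++ Γ₁)
    ax   : ∀ A → ⊢ (A ∷ (A ᗮ) ∷ [])
    ⊗R   : ∀ Γ A B Δ → ⊢ (Γ ++ A ∷ []) → ⊢ (B ∷ Δ) → ⊢ (Γ ++ (A ⊗ B) ∷ Δ)
    ⅋R   : ∀ A B Γ → ⊢ (A ∷ B ∷ Γ) → ⊢ ((A ⅋ B) ∷ Γ)
    &R   : ∀ A₁ A₂ Γ → ⊢ (A₁ ∷ Γ) → ⊢ (A₂ ∷ Γ) → ⊢ ((A₁ & A₂) ∷ Γ)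
    ⊕R₁  : ∀ A₁ A₂ Γ → ⊢ (A₁ ∷ Γ) → ⊢ ((A₁ ⊕ A₂) ∷ Γ)
    ⊕R₂  : ∀ A₁ A₂ Γ → ⊢ (A₂ ∷ Γ) → ⊢ ((A₁ ⊕ A₂) ∷ Γ)
    𝟙R   : ⊢ (𝟙 ∷ [])
    ⊥R   : ∀ Γ → ⊢ Γ → ⊢ (⊥ᶠ ∷ Γ)
    ⊤R   : ∀ Γ → ⊢ (⊤ᶠ ∷ Γ)
    !R   : ∀ s B (ctx : List (Label × Fm)) →
           All (λ p → s ≼ Data.Product.proj₁ p) ctx →
           ⊢ (B ∷ ？ctx ctx) → ⊢ (！ s B ∷ ？ctx ctx)
    ?R   : ∀ s A Γ → ⊢ (A ∷ Γ) → ⊢ (？ s A ∷ Γ)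
    weak : ∀ s A Γ → W s → ⊢ Γ → ⊢ (？ s A ∷ Γ)
    contr : ∀ s A Γ Δ → C s → ⊢ (？ s A ∷ Γ ++ ？ s A ∷ Δ) → ⊢ (？ s A ∷ Γ ++ Δ)
    exch : ∀ s A Γ Δ → E s → ⊢ (Γ ++ ？ s A ∷ Δ) → ⊢ (？ s A ∷ Γ ++ Δ)

  data Translated : Fm → Set where
    plain   : ∀ C → Translated (tr C)
    negated : ∀ C → Translated (tr C ᗮ)

module Submission where

open import Defs
open import Data.Integer using (ℤ; +_; _+_; _-_)
open import Data.List using (List; length; map; foldr)
open import Data.List.Relation.Unary.All using (All)
open import Data.Product using (_×_)
open import Relation.Binary.PropositionalEquality using (_≡_)

open import Data.Integer.Properties using (+-identityˡ; +-0-isCommutativeMonoid)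
open import Data.Integer.Tactic.RingSolver using (solve-∀)
open import Data.List using ([]; _∷_; _++_)
open import Data.List.Relation.Binary.Permutation.Propositional
  using (_↭_; prep; ↭-sym; ↭⇒↭ₛ)
open import Data.List.Relation.Binary.Permutation.Propositional.Properties
  using (++-comm; shift; All-resp-↭)
  renaming (map⁺ to ↭-map⁺)
open import Data.List.Relation.Binary.Permutation.Setoid.Properties using (foldr-commMonoid)
open import Data.List.Relation.Unary.All using ([]; _∷_)
  renaming (map to All-map)
open import Data.List.Relation.Unary.All.Properties using (++⁺; ++⁻)
open import Data.Product using (_,_; proj₁)
open import Data.Sum using (_⊎_; inj₁; inj₂)
open import Function using (_∘_)
open import Relation.Binary.PropositionalEquality
  using (refl; sym; trans; cong; cong₂; setoid; module ≡-Reasoning)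

-- Translated formulas are recognised syntactically: Ĉ is "plain" and Ĉ^⊥ is
-- "negated", where the two classes are defined by mutual induction following
-- the clauses of the translation and of linear negation.  On plain formulas
-- ♮ is 0 and on negated ones it is 1, so ♮ sums to n - 1 over a sequent of
-- length n exactly when the weight 1 - ♮ sums to 1.  That is an invariant of
-- every rule: the axiom pairs a plain formula with a negated one, ⊗ joins two
-- sequents of weight 1, and everything a structural rule may add, copy or
-- discard is a ?-formula, which is negated and so has weight 0.

module Polarised (Σ : Signature) where

  data Plain : Fm Σ → Set
  data Negated : Fm Σ → Set

  data Plain where
    pos   : ∀ i → Plain (pos i)
    𝟙     : Plain 𝟙
    _⊗_   : ∀ {A B} → Plain A → Plain B → Plain (A ⊗ B)
    _⁻⅋⁺_ : ∀ {A B} → Negated A → Plain B → Plain (A ⅋ B)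
    _⁺⅋⁻_ : ∀ {A B} → Plain A → Negated B → Plain (A ⅋ B)
    _&_   : ∀ {A B} → Plain A → Plain B → Plain (A & B)
    _⊕_   : ∀ {A B} → Plain A → Plain B → Plain (A ⊕ B)
    ！    : ∀ {s A} → Plain A → Plain (！ s A)

  data Negated where
    neg   : ∀ i → Negated (neg i)
    ⊥ᶠ    : Negated ⊥ᶠ
    _⅋_   : ∀ {A B} → Negated A → Negated B → Negated (A ⅋ B)
    _⁻⊗⁺_ : ∀ {A B} → Negated A → Plain B → Negated (A ⊗ B)
    _⁺⊗⁻_ : ∀ {A B} → Plain A → Negated B → Negated (A ⊗ B)
    _&_   : ∀ {A B} → Negated A → Negated B → Negated (A & B)
    _⊕_   : ∀ {A B} → Negated A → Negated B → Negated (A ⊕ B)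
    ？    : ∀ {s A} → Negated A → Negated (？ s A)

  Polar : Fm Σ → Set
  Polar A = Plain A ⊎ Negated A

  ᗮ-plain : ∀ {A} → Plain A → Negated (_ᗮ Σ A)
  ᗮ-negated : ∀ {A} → Negated A → Plain (_ᗮ Σ A)

  ᗮ-plain (pos i)   = neg i
  ᗮ-plain 𝟙         = ⊥ᶠ
  ᗮ-plain (a ⊗ b)   = ᗮ-plain b ⅋ ᗮ-plain a
  ᗮ-plain (a ⁻⅋⁺ b) = ᗮ-plain b ⁻⊗⁺ ᗮ-negated a
  ᗮ-plain (a ⁺⅋⁻ b) = ᗮ-negated b ⁺⊗⁻ ᗮ-plain a
  ᗮ-plain (a & b)   = ᗮ-plain a ⊕ ᗮ-plain b
  ᗮ-plain (a ⊕ b)   = ᗮ-plain a & ᗮ-plain b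
  ᗮ-plain (！ a)    = ？ (ᗮ-plain a)

  ᗮ-negated (neg i)   = pos i
  ᗮ-negated ⊥ᶠ        = 𝟙
  ᗮ-negated (a ⅋ b)   = ᗮ-negated b ⊗ ᗮ-negated a
  ᗮ-negated (a ⁻⊗⁺ b) = ᗮ-plain b ⁻⅋⁺ ᗮ-negated a
  ᗮ-negated (a ⁺⊗⁻ b) = ᗮ-negated b ⁺⅋⁻ ᗮ-plain a
  ᗮ-negated (a & b)   = ᗮ-negated a ⊕ ᗮ-negated b
  ᗮ-negated (a ⊕ b)   = ᗮ-negated a & ᗮ-negated b
  ᗮ-negated (？ a)    = ！ (ᗮ-negated a)

  plain-tr : ∀ C → Plain (tr Σ C)
  plain-tr (var i)  = pos i
  plain-tr one      = 𝟙
  plain-tr (A · B)  = plain-tr A ⊗ plain-tr B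
  plain-tr (A ＼ B) = ᗮ-plain (plain-tr A) ⁻⅋⁺ plain-tr B
  plain-tr (B ／ A) = plain-tr B ⁺⅋⁻ ᗮ-plain (plain-tr A)
  plain-tr (A ∧ B)  = plain-tr A & plain-tr B
  plain-tr (A ∨ B)  = plain-tr A ⊕ plain-tr B
  plain-tr (!ₘ s A) = ！ (plain-tr A)

  translated⇒polar : ∀ {A} → Translated Σ A → Polar A
  translated⇒polar (plain C)   = inj₁ (plain-tr C)
  translated⇒polar (negated C) = inj₂ (ᗮ-plain (plain-tr C))

  ♮-plain : ∀ {A} → Plain A → ♮ Σ A ≡ + 0
  ♮-negated : ∀ {A} → Negated A → ♮ Σ A ≡ + 1

  ♮-plain (pos i) = refl
  ♮-plain 𝟙       = refl
  ♮-plain (a ⊗ b)   rewrite ♮-plain a   | ♮-plain b   = refl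
  ♮-plain (a ⁻⅋⁺ b) rewrite ♮-negated a | ♮-plain b   = refl
  ♮-plain (a ⁺⅋⁻ b) rewrite ♮-plain a   | ♮-negated b = refl
  ♮-plain (a & _) = ♮-plain a
  ♮-plain (a ⊕ _) = ♮-plain a
  ♮-plain (！ a)  = ♮-plain a

  ♮-negated (neg i) = refl
  ♮-negated ⊥ᶠ      = refl
  ♮-negated (a ⅋ b)   rewrite ♮-negated a | ♮-negated b = refl
  ♮-negated (a ⁻⊗⁺ b) rewrite ♮-negated a | ♮-plain b   = refl
  ♮-negated (a ⁺⊗⁻ b) rewrite ♮-plain a   | ♮-negated b = refl
  ♮-negated (a & _) = ♮-negated a
  ♮-negated (a ⊕ _) = ♮-negated a
  ♮-negated (？ a)  = ♮-negated a

  ♮-⊕ : ∀ {A B} → Polar (A ⊕ B) → ♮ Σ A ≡ ♮ Σ B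
  ♮-⊕ (inj₁ (a ⊕ b)) = trans (♮-plain a) (sym (♮-plain b))
  ♮-⊕ (inj₂ (a ⊕ b)) = trans (♮-negated a) (sym (♮-negated b))

  polar-⊗⁻ : ∀ {A B} → Polar (A ⊗ B) → Polar A × Polar B
  polar-⊗⁻ (inj₁ (a ⊗ b))   = inj₁ a , inj₁ b
  polar-⊗⁻ (inj₂ (a ⁻⊗⁺ b)) = inj₂ a , inj₁ b
  polar-⊗⁻ (inj₂ (a ⁺⊗⁻ b)) = inj₁ a , inj₂ b

  polar-⅋⁻ : ∀ {A B} → Polar (A ⅋ B) → Polar A × Polar B
  polar-⅋⁻ (inj₁ (a ⁻⅋⁺ b)) = inj₂ a , inj₁ b
  polar-⅋⁻ (inj₁ (a ⁺⅋⁻ b)) = inj₁ a , inj₂ b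
  polar-⅋⁻ (inj₂ (a ⅋ b))   = inj₂ a , inj₂ b

  polar-&⁻ : ∀ {A B} → Polar (A & B) → Polar A × Polar B
  polar-&⁻ (inj₁ (a & b)) = inj₁ a , inj₁ b
  polar-&⁻ (inj₂ (a & b)) = inj₂ a , inj₂ b

  polar-⊕⁻ : ∀ {A B} → Polar (A ⊕ B) → Polar A × Polar B
  polar-⊕⁻ (inj₁ (a ⊕ b)) = inj₁ a , inj₁ b
  polar-⊕⁻ (inj₂ (a ⊕ b)) = inj₂ a , inj₂ b

  polar-！⁻ : ∀ {s A} → Polar (！ s A) → Polar A
  polar-！⁻ (inj₁ (！ a)) = inj₁ a

  polar-？⁻ : ∀ {s A} → Polar (？ s A) → Negated A
  polar-？⁻ (inj₂ (？ a)) = a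

  weight : Fm Σ → ℤ
  weight A = + 1 - ♮ Σ A

  excess : List (Fm Σ) → ℤ
  excess Γ = foldr _+_ (+ 0) (map weight Γ)

  excess-++ : ∀ Γ Δ → excess (Γ ++ Δ) ≡ excess Γ + excess Δ
  excess-++ []      Δ = sym (+-identityˡ (excess Δ))
  excess-++ (A ∷ Γ) Δ =
    trans (cong (_+_ (weight A)) (excess-++ Γ Δ)) (assoc (weight A) (excess Γ) (excess Δ))
    where
    assoc : ∀ a g d → a + (g + d) ≡ a + g + d
    assoc = solve-∀

  excess-↭ : ∀ {Γ Δ} → Γ ↭ Δ → excess Γ ≡ excess Δ
  excess-↭ = foldr-commMonoid (setoid ℤ) +-0-isCommutativeMonoid ∘ ↭⇒↭ₛ ∘ ↭-map⁺ weight

  excess-null : ∀ A Γ → weight A ≡ + 0 → excess (A ∷ Γ) ≡ excess Γ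
  excess-null A Γ w = trans (cong (_+ excess Γ) w) (+-identityˡ (excess Γ))

  weight-？ : ∀ {s A} → Polar (？ s A) → weight (？ s A) ≡ + 0
  weight-？ p = cong (+ 1 -_) (♮-negated (polar-？⁻ p))

  excess-axiom : ∀ {A} → Polar A → excess (A ∷ _ᗮ Σ A ∷ []) ≡ + 1
  excess-axiom (inj₁ a) rewrite ♮-plain a | ♮-negated (ᗮ-plain a) = refl
  excess-axiom (inj₂ a) rewrite ♮-negated a | ♮-plain (ᗮ-negated a) = refl

  excess-⅋ : ∀ A B Γ → excess (A ⅋ B ∷ Γ) ≡ excess (A ∷ B ∷ Γ)
  excess-⅋ A B Γ = split (♮ Σ A) (♮ Σ B) (excess Γ)
    where
    split : ∀ a b g → + 1 - (a + b - + 1) + g ≡ + 1 - a + (+ 1 - b + g)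
    split = solve-∀

  excess-⊗ : ∀ Γ A B Δ →
             excess (Γ ++ A ⊗ B ∷ Δ) ≡ excess (Γ ++ A ∷ []) + excess (B ∷ Δ) - + 1
  excess-⊗ Γ A B Δ = begin
    excess (Γ ++ A ⊗ B ∷ Δ)
      ≡⟨ excess-↭ (shift (A ⊗ B) Γ Δ) ⟩
    weight (A ⊗ B) + excess (Γ ++ Δ)
      ≡⟨ cong (_+_ (weight (A ⊗ B))) (excess-++ Γ Δ) ⟩
    weight (A ⊗ B) + (excess Γ + excess Δ)
      ≡⟨ split (♮ Σ A) (♮ Σ B) (excess Γ) (excess Δ) ⟩
    excess (A ∷ Γ) + excess (B ∷ Δ) - + 1
      ≡⟨ cong (λ x → x + excess (B ∷ Δ) - + 1) (excess-↭ (++-comm Γ (A ∷ []))) ⟨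
    excess (Γ ++ A ∷ []) + excess (B ∷ Δ) - + 1
      ∎
    where
    open ≡-Reasoning
    split : ∀ a b g d → + 1 - (a + b) + (g + d) ≡ (+ 1 - a + g) + (+ 1 - b + d) - + 1
    split = solve-∀

  excess-derivable : ∀ {Γ} → All Polar Γ → ⊢_ Σ Γ → excess Γ ≡ + 1
  excess-derivable ps (rot Γ₁ Γ₂ d) =
    trans (excess-↭ (++-comm Γ₂ Γ₁)) (excess-derivable (All-resp-↭ (++-comm Γ₂ Γ₁) ps) d)
  excess-derivable (p ∷ _) (ax A) = excess-axiom p
  excess-derivable ps (⊗R Γ A B Δ d e) with ++⁻ Γ ps
  ... | pΓ , pAB ∷ pΔ with polar-⊗⁻ pAB
  ... | pA , pB =
    trans (excess-⊗ Γ A B Δ) (cong₂ (λ x y → x + y - + 1)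
      (excess-derivable (++⁺ pΓ (pA ∷ [])) d) (excess-derivable (pB ∷ pΔ) e))
  excess-derivable (p ∷ ps) (⅋R A B Γ d) with polar-⅋⁻ p
  ... | pA , pB = trans (excess-⅋ A B Γ) (excess-derivable (pA ∷ pB ∷ ps) d)
  excess-derivable (p ∷ ps) (&R A₁ A₂ Γ d _) = excess-derivable (proj₁ (polar-&⁻ p) ∷ ps) d
  excess-derivable (p ∷ ps) (⊕R₁ A₁ A₂ Γ d) = excess-derivable (proj₁ (polar-⊕⁻ p) ∷ ps) d
  excess-derivable (p ∷ ps) (⊕R₂ A₁ A₂ Γ d) with polar-⊕⁻ p
  ... | _ , p₂ =
    trans (cong (λ n → + 1 - n + excess Γ) (♮-⊕ p)) (excess-derivable (p₂ ∷ ps) d)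
  excess-derivable _ 𝟙R = refl
  excess-derivable (_ ∷ ps) (⊥R Γ d) = trans (excess-null ⊥ᶠ Γ refl) (excess-derivable ps d)
  excess-derivable (inj₁ () ∷ _) (⊤R Γ)
  excess-derivable (inj₂ () ∷ _) (⊤R Γ)
  excess-derivable (p ∷ ps) (!R s B ctx _ d) = excess-derivable (polar-！⁻ p ∷ ps) d
  excess-derivable (p ∷ ps) (?R s A Γ d) = excess-derivable (inj₂ (polar-？⁻ p) ∷ ps) d
  excess-derivable (p ∷ ps) (weak s A Γ _ d) =
    trans (excess-null (？ s A) Γ (weight-？ p)) (excess-derivable ps d)
  excess-derivable (p ∷ ps) (contr s A Γ Δ _ d) = begin
    excess (？ s A ∷ Γ ++ Δ)
      ≡⟨ cong (_+_ (weight (？ s A))) (excess-null (？ s A) (Γ ++ Δ) (weight-？ p)) ⟨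
    excess (？ s A ∷ ？ s A ∷ Γ ++ Δ)
      ≡⟨ excess-↭ (prep (？ s A) moved) ⟨
    excess (？ s A ∷ Γ ++ ？ s A ∷ Δ)
      ≡⟨ excess-derivable (p ∷ All-resp-↭ (↭-sym moved) (p ∷ ps)) d ⟩
    + 1
      ∎
    where
    open ≡-Reasoning
    moved : Γ ++ ？ s A ∷ Δ ↭ ？ s A ∷ Γ ++ Δ
    moved = shift (？ s A) Γ Δ
  excess-derivable ps (exch s A Γ Δ _ d) =
    trans (excess-↭ moved) (excess-derivable (All-resp-↭ moved ps) d)
    where
    moved : ？ s A ∷ Γ ++ Δ ↭ Γ ++ ？ s A ∷ Δ
    moved = ↭-sym (shift (？ s A) Γ Δ)

  ♮-sum+excess : ∀ Γ → foldr _+_ (+ 0) (map (♮ Σ) Γ) + excess Γ ≡ + length Γ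
  ♮-sum+excess []      = refl
  ♮-sum+excess (A ∷ Γ) =
    trans (regroup (♮ Σ A) _ (excess Γ)) (cong (_+_ (+ 1)) (♮-sum+excess Γ))
    where
    regroup : ∀ a s e → a + s + (+ 1 - a + e) ≡ + 1 + (s + e)
    regroup = solve-∀

  ♮-sum-derivable : ∀ {Γ} → All Polar Γ → ⊢_ Σ Γ →
                    foldr _+_ (+ 0) (map (♮ Σ) Γ) ≡ + length Γ - + 1
  ♮-sum-derivable {Γ} ps d = begin
    s                  ≡⟨ cancel s ⟨
    s + + 1 - + 1      ≡⟨ cong (λ e → s + e - + 1) (excess-derivable ps d) ⟨
    s + excess Γ - + 1 ≡⟨ cong (_- + 1) (♮-sum+excess Γ) ⟩
    + length Γ - + 1   ∎
    where
    open ≡-Reasoning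
    s : ℤ
    s = foldr _+_ (+ 0) (map (♮ Σ) Γ)
    cancel : ∀ x → x + + 1 - + 1 ≡ x
    cancel = solve-∀

lemma1 : (Σ : Signature) →
    ((A : MFm Σ) → ♮ Σ (tr Σ A) ≡ + 0)
    × ((A : MFm Σ) → ♮ Σ (_ᗮ Σ (tr Σ A)) ≡ + 1)
    × ((A B : Fm Σ) → Translated Σ (_⊕_ {Σ} A B) →
    (♮ Σ A ≡ ♮ Σ B) × (♮ Σ B ≡ ♮ Σ (_⊕_ {Σ} A B)))
    × ((Γ : List (Fm Σ)) → All (Translated Σ) Γ → ⊢_ Σ Γ →
    foldr _+_ (+ 0) (map (♮ Σ) Γ) ≡ + length Γ - + 1)
lemma1 Σ =
    ♮-plain ∘ plain-tr
  , ♮-negated ∘ ᗮ-plain ∘ plain-tr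
  , (λ A B t → let ♮A≡♮B = ♮-⊕ (translated⇒polar t) in ♮A≡♮B , sym ♮A≡♮B)
  , (λ Γ ts → ♮-sum-derivable (All-map translated⇒polar ts))
  where open Polarised Σ
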